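{- Let $G$ be a connected graph with at least one edge. The following are equivalent: (a) $\kappa_f(G) = 2$; (b) $T_G(b) = 2b$ for some integer $b\ge 1$; (c) $T_G(b)=2b$ for all integers $b\ge1$; (d) $G$ is bipartite.
   Context: A vertex cover of $G$ is a set $S$ of vertices such that $V(G)\setminus S$ is independent. $\kappa_f(G)$ is the optimal value of $\max\sum_S y_S$ over all vertex covers $S$ of $G$, subject to $\sum_{S\ni v}y_S\le1$ for all $v\in V(G)$, $y\ge 0$. For a family (with repetitions allowed) $S_1,\dots,S_t$ of vertex covers, its budget is $\max_{v}|\{i:v\in S_i\}|$; $T_G(b)$ is the largest $t$ such that some family of $t$ vertex covers of $G$ has budget at most $b$.
   Formalization: The weights $y_S$ in the linear program defining $\kappa_f(G)$ take rational values. -}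

module Defs where

open import Data.Nat using (ℕ; zero; suc; _≤_; _*_)
open import Data.Bool using (Bool; true; false; if_then_else_)
open import Data.Fin using (Fin)
open import Data.Fin.Subset using (Subset; _∈_)
open import Data.Vec using (lookup)
open import Data.List using (List; []; _∷_; length)
open import Data.List.Relation.Unary.All using (All)
open import Data.Product using (Σ; ∃; _×_; _,_; proj₁; proj₂)
open import Data.Sum using (_⊎_)
open import Relation.Binary.PropositionalEquality using (_≡_; _≢_)
open import Data.Rational as ℚ using (ℚ; 0ℚ; 1ℚ)

record Graph (n : ℕ) : Set where
  field
    adj    : Fin n → Fin n → Bool
    sym    : ∀ u v → adj u v ≡ adj v u
    irrefl : ∀ v → adj v v ≡ false
open Graph public

module _ {n : ℕ} (G : Graph n) where

  Edge : Fin n → Fin n → Set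
  Edge u v = adj G u v ≡ true

  data Reachable : Fin n → Fin n → Set where
    here : ∀ {u} → Reachable u u
    step : ∀ {u w v} → Edge u w → Reachable w v → Reachable u v

  Connected : Set
  Connected = ∀ u v → Reachable u v

  HasEdge : Set
  HasEdge = ∃ λ u → ∃ λ v → Edge u v

  Bipartite : Set
  Bipartite = Σ (Fin n → Bool) λ c → ∀ u v → Edge u v → c u ≢ c v

  IsVertexCover : Subset n → Set
  IsVertexCover S = ∀ u v → Edge u v → u ∈ S ⊎ v ∈ S

  count : Fin n → List (Subset n) → ℕ
  count v [] = 0
  count v (S ∷ F) = if lookup S v then suc (count v F) else count v F

  BudgetAtMost : List (Subset n) → ℕ → Set
  BudgetAtMost F b = ∀ v → count v F ≤ b

  CoverFamily : List (Subset n) → Set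
  CoverFamily F = All IsVertexCover F

  T-equals : ℕ → ℕ → Set
  T-equals b t =
    (Σ (List (Subset n)) λ F → CoverFamily F × BudgetAtMost F b × length F ≡ t)
    × (∀ F → CoverFamily F → BudgetAtMost F b → length F ≤ t)

  -- fractional packings: a finite list of (vertex cover, weight) pairs;
  -- this is y with finite support (repeated covers just add weights).
  weightAt : Fin n → List (Subset n × ℚ) → ℚ
  weightAt v [] = 0ℚ
  weightAt v ((S , w) ∷ F) = if lookup S v then w ℚ.+ weightAt v F else weightAt v F

  total : List (Subset n × ℚ) → ℚ
  total [] = 0ℚ
  total ((S , w) ∷ F) = w ℚ.+ total F

  Feasible : List (Subset n × ℚ) → Set
  Feasible y = All (λ p → IsVertexCover (proj₁ p) × 0ℚ ℚ.≤ proj₂ p) y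
             × (∀ v → weightAt v y ℚ.≤ 1ℚ)

  KappaF-equals : ℚ → Set
  KappaF-equals k =
    (Σ (List (Subset n × ℚ)) λ y → Feasible y × total y ≡ k)
    × (∀ y → Feasible y → total y ℚ.≤ k)

-- Every vertex cover meets each edge uv, so in any family of vertex covers the loads of u
-- and v add up to the size (total weight) of the family plus the weight of the members
-- containing both u and v.  With loads bounded by b (resp. 1) this gives T_G(b) ≤ 2b and
-- κ_f(G) ≤ 2 as soon as G has an edge; at equality no member of positive weight contains an
-- edge, i.e. it is an independent vertex cover, and its indicator is a proper 2-colouring.
-- Conversely the two colour classes of a bipartite graph are vertex covers attaining both
-- bounds.

module Submission where

open import Defs hiding (sym)
open import Data.Nat using (ℕ; zero; suc; _+_; _≥_; _*_)
open import Data.Product using (_×_; ∃; _,_; proj₁; proj₂)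
open import Data.Rational using (ℚ; 0ℚ; 1ℚ; _≤_; _<_; _≤?_; _<?_)
open import Function.Bundles using (_⇔_; mk⇔)

open import Algebra.Bundles using (CommutativeSemigroup; CommutativeMonoid)
import Algebra.Properties.CommutativeSemigroup as CommutativeSemigroupProperties
open import Data.Bool using (Bool; true; false; not; _∧_; if_then_else_)
open import Data.Bool.Properties using (not-injective)
open import Data.Empty using (⊥-elim)
open import Data.Fin using (Fin)
open import Data.Fin.Subset using (Subset)
open import Data.List using (List; []; _∷_; length)
open import Data.List.Membership.Propositional using (_∈_; find)
open import Data.List.Relation.Unary.All as All using (All; []; _∷_)
open import Data.List.Relation.Unary.All.Properties using (¬Any⇒All¬)
open import Data.List.Relation.Unary.Any using (here; there; any?)
import Data.Nat as ℕ
import Data.Nat.Properties as ℕ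
import Data.Rational as ℚ
import Data.Rational.Properties as ℚ
open import Data.Sum using (_⊎_; inj₁; inj₂)
open import Data.Unit using (tt)
open import Data.Vec using (lookup; tabulate)
open import Data.Vec.Properties using ([]=⇒lookup; lookup⇒[]=; lookup∘tabulate)
open import Function using (_∘_)
open import Relation.Binary.PropositionalEquality as ≡ using (_≡_; _≢_; refl; cong)
open import Relation.Nullary using (yes; no)
open import Relation.Nullary.Decidable using (toWitness)

module _ {c ℓ} (S : CommutativeSemigroup c ℓ) where
  open CommutativeSemigroup S
  open CommutativeSemigroupProperties S
  open import Relation.Binary.Reasoning.Setoid setoid

  -- A member of weight w of a family of vertex covers meets every edge uv:
  -- it adds w to load(u) + load(v), and a second w exactly when it contains both.
  if∙if≈∙-if∧ : ∀ (a b : Bool) {w x y t z} →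
                a ≡ true ⊎ b ≡ true → x ∙ y ≈ t ∙ z →
                (if a then w ∙ x else x) ∙ (if b then w ∙ y else y)
                  ≈ (w ∙ t) ∙ (if a ∧ b then w ∙ z else z)
  if∙if≈∙-if∧ true true {w} {x} {y} {t} {z} _ eq = begin
    (w ∙ x) ∙ (w ∙ y) ≈⟨ interchange w x w y ⟩
    (w ∙ w) ∙ (x ∙ y) ≈⟨ ∙-congˡ eq ⟩
    (w ∙ w) ∙ (t ∙ z) ≈⟨ interchange w w t z ⟩
    (w ∙ t) ∙ (w ∙ z) ∎
  if∙if≈∙-if∧ true false {w} {x} {y} {t} {z} _ eq = begin
    (w ∙ x) ∙ y ≈⟨ assoc w x y ⟩
    w ∙ (x ∙ y) ≈⟨ ∙-congˡ eq ⟩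
    w ∙ (t ∙ z) ≈⟨ sym (assoc w t z) ⟩
    (w ∙ t) ∙ z ∎
  if∙if≈∙-if∧ false true {w} {x} {y} {t} {z} _ eq = begin
    x ∙ (w ∙ y) ≈⟨ x∙yz≈y∙xz x w y ⟩
    w ∙ (x ∙ y) ≈⟨ ∙-congˡ eq ⟩
    w ∙ (t ∙ z) ≈⟨ sym (assoc w t z) ⟩
    (w ∙ t) ∙ z ∎
  if∙if≈∙-if∧ false false (inj₁ ())
  if∙if≈∙-if∧ false false (inj₂ ())

two : ℚ
two = 1ℚ ℚ.+ 1ℚ

p≤p+q : ∀ {p q} → 0ℚ ≤ q → p ≤ p ℚ.+ q
p≤p+q {p} {q} 0≤q =
  ℚ.≤-trans (ℚ.≤-reflexive (≡.sym (ℚ.+-identityʳ p))) (ℚ.+-monoʳ-≤ p 0≤q)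

p<p+q : ∀ {p q} → 0ℚ < q → p < p ℚ.+ q
p<p+q {p} {q} 0<q =
  ℚ.≤-<-trans (ℚ.≤-reflexive (≡.sym (ℚ.+-identityʳ p))) (ℚ.+-monoʳ-< p 0<q)

≤-if-+ : ∀ a {w x} → 0ℚ ≤ w → x ≤ (if a then w ℚ.+ x else x)
≤-if-+ true {w} {x} 0≤w = ℚ.≤-trans (p≤p+q 0≤w) (ℚ.≤-reflexive (ℚ.+-comm x w))
≤-if-+ false _ = ℚ.≤-refl

module _ {n : ℕ} (G : Graph n) where

  ProperColouring : (Fin n → Bool) → Set
  ProperColouring c = ∀ u v → Edge G u v → c u ≢ c v

  Independent : Subset n → Set
  Independent S = ∀ u v → Edge G u v → lookup S u ∧ lookup S v ≢ true

  vertexCover-meets : ∀ {S u v} → IsVertexCover G S → Edge G u v →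
                      lookup S u ≡ true ⊎ lookup S v ≡ true
  vertexCover-meets {S} {u} {v} cover e with cover u v e
  ... | inj₁ u∈S = inj₁ ([]=⇒lookup u∈S)
  ... | inj₂ v∈S = inj₂ ([]=⇒lookup v∈S)

  independentCover⇒bipartite : ∀ S → IsVertexCover G S → Independent S → Bipartite G
  independentCover⇒bipartite S cover indep = lookup S , proper
    where
    proper : ProperColouring (lookup S)
    proper u v e Su≡Sv
      with lookup S u | lookup S v | vertexCover-meets {S} cover e | indep u v e
    ... | true  | true  | _ | both∉S = both∉S refl
    ... | false | false | inj₁ () | _
    ... | false | false | inj₂ () | _

  colourClass-vertexCover : ∀ c → ProperColouring c → IsVertexCover G (tabulate c)
  colourClass-vertexCover c proper u v e with c u in cu | c v in cv | proper u v e
  ... | true  | _     | _  = inj₁ (lookup⇒[]= u _ (≡.trans (lookup∘tabulate c u) cu))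
  ... | false | true  | _  = inj₂ (lookup⇒[]= v _ (≡.trans (lookup∘tabulate c v) cv))
  ... | false | false | cu≢cv = ⊥-elim (cu≢cv refl)

  not-properColouring : ∀ {c} → ProperColouring c → ProperColouring (not ∘ c)
  not-properColouring {c} proper u v e = proper u v e ∘ not-injective

  countBoth : Fin n → Fin n → List (Subset n) → ℕ
  countBoth u v [] = 0
  countBoth u v (S ∷ F) =
    if lookup S u ∧ lookup S v then suc (countBoth u v F) else countBoth u v F

  count+count≡length+countBoth : ∀ {u v} F → CoverFamily G F → Edge G u v →
                                 count G u F + count G v F ≡ length F + countBoth u v F
  count+count≡length+countBoth [] [] e = refl
  count+count≡length+countBoth {u} {v} (S ∷ F) (cover ∷ covers) e =
    if∙if≈∙-if∧ ℕ.+-commutativeSemigroup (lookup S u) (lookup S v)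
      (vertexCover-meets {S} cover e) (count+count≡length+countBoth F covers e)

  length+countBoth≤2*b : ∀ {u v b} F → CoverFamily G F → BudgetAtMost G F b → Edge G u v →
                         length F + countBoth u v F ℕ.≤ 2 * b
  length+countBoth≤2*b {u} {v} {b} F covers budget e = begin
    length F + countBoth u v F ≡⟨ ≡.sym (count+count≡length+countBoth F covers e) ⟩
    count G u F + count G v F  ≤⟨ ℕ.+-mono-≤ (budget u) (budget v) ⟩
    b + b                      ≡⟨ cong (b +_) (≡.sym (ℕ.+-identityʳ b)) ⟩
    2 * b                      ∎
    where open ℕ.≤-Reasoning

  countBoth-∷ : ∀ {u v} S F → lookup S u ∧ lookup S v ≡ true →
                countBoth u v (S ∷ F) ≡ suc (countBoth u v F)
  countBoth-∷ S F both∈S rewrite both∈S = refl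

  T⇒bipartite : ∀ b → b ≥ 1 → T-equals G b (2 * b) → Bipartite G
  T⇒bipartite zero () _
  T⇒bipartite (suc b) _ (([] , _ , _ , ()) , _)
  T⇒bipartite b _ ((S ∷ F , cover ∷ covers , budget , len) , _) =
    independentCover⇒bipartite S cover independent
    where
    independent : Independent S
    independent u v e both∈S = ℕ.m+1+n≰m (2 * b) (begin
      2 * b + suc (countBoth u v F)
        ≡⟨ ≡.cong₂ _+_ (≡.sym len) (≡.sym (countBoth-∷ S F both∈S)) ⟩
      length (S ∷ F) + countBoth u v (S ∷ F)
        ≤⟨ length+countBoth≤2*b (S ∷ F) (cover ∷ covers) budget e ⟩
      2 * b                                  ∎)
      where open ℕ.≤-Reasoning

  colourClassCopies : (Fin n → Bool) → ℕ → List (Subset n)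
  colourClassCopies c zero = []
  colourClassCopies c (suc b) = tabulate c ∷ tabulate (not ∘ c) ∷ colourClassCopies c b

  count-colourClasses : ∀ c v F →
    count G v (tabulate c ∷ tabulate (not ∘ c) ∷ F) ≡ suc (count G v F)
  count-colourClasses c v F
    rewrite lookup∘tabulate c v | lookup∘tabulate (not ∘ c) v with c v
  ... | true  = refl
  ... | false = refl

  count-colourClassCopies : ∀ c b v → count G v (colourClassCopies c b) ≡ b
  count-colourClassCopies c zero v = refl
  count-colourClassCopies c (suc b) v =
    ≡.trans (count-colourClasses c v (colourClassCopies c b))
            (cong suc (count-colourClassCopies c b v))

  length-colourClassCopies : ∀ c b → length (colourClassCopies c b) ≡ 2 * b
  length-colourClassCopies c zero = refl
  length-colourClassCopies c (suc b) =
    ≡.trans (cong (2 +_) (length-colourClassCopies c b)) (≡.sym (ℕ.*-suc 2 b))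

  colourClassCopies-coverFamily : ∀ c → ProperColouring c → ∀ b →
                                  CoverFamily G (colourClassCopies c b)
  colourClassCopies-coverFamily c proper zero = []
  colourClassCopies-coverFamily c proper (suc b) =
    colourClass-vertexCover c proper
      ∷ colourClass-vertexCover (not ∘ c) (not-properColouring proper)
      ∷ colourClassCopies-coverFamily c proper b

  bipartite⇒T : HasEdge G → Bipartite G → ∀ b → T-equals G b (2 * b)
  bipartite⇒T (_ , _ , e) (c , proper) b =
    ( colourClassCopies c b
    , colourClassCopies-coverFamily c proper b
    , (λ v → ℕ.≤-reflexive (count-colourClassCopies c b v))
    , length-colourClassCopies c b )
    , λ F covers budget → ℕ.m+n≤o⇒m≤o (length F) (length+countBoth≤2*b F covers budget e)

  bothWeight : Fin n → Fin n → List (Subset n × ℚ) → ℚ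
  bothWeight u v [] = 0ℚ
  bothWeight u v ((S , w) ∷ y) =
    if lookup S u ∧ lookup S v then w ℚ.+ bothWeight u v y else bothWeight u v y

  weightAt+weightAt≡total+bothWeight : ∀ {u v} y → All (IsVertexCover G ∘ proj₁) y →
    Edge G u v → weightAt G u y ℚ.+ weightAt G v y ≡ total G y ℚ.+ bothWeight u v y
  weightAt+weightAt≡total+bothWeight [] [] e = refl
  weightAt+weightAt≡total+bothWeight {u} {v} ((S , w) ∷ y) (cover ∷ covers) e =
    if∙if≈∙-if∧ (CommutativeMonoid.commutativeSemigroup ℚ.+-0-commutativeMonoid)
      (lookup S u) (lookup S v) {w} (vertexCover-meets {S} cover e)
      (weightAt+weightAt≡total+bothWeight y covers e)

  NonNegativeWeights : List (Subset n × ℚ) → Set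
  NonNegativeWeights = All (λ p → 0ℚ ≤ proj₂ p)

  bothWeight-nonNegative : ∀ {u v} y → NonNegativeWeights y → 0ℚ ≤ bothWeight u v y
  bothWeight-nonNegative [] [] = ℚ.≤-refl
  bothWeight-nonNegative {u} {v} ((S , w) ∷ y) (0≤w ∷ nonNeg) =
    ℚ.≤-trans (bothWeight-nonNegative y nonNeg) (≤-if-+ (lookup S u ∧ lookup S v) 0≤w)

  ∈⇒≤bothWeight : ∀ {u v S w} y → NonNegativeWeights y → (S , w) ∈ y →
                  lookup S u ∧ lookup S v ≡ true → w ≤ bothWeight u v y
  ∈⇒≤bothWeight (_ ∷ y) (_ ∷ nonNeg) (here refl) both∈S rewrite both∈S =
    p≤p+q (bothWeight-nonNegative y nonNeg)
  ∈⇒≤bothWeight {u} {v} ((S′ , _) ∷ y) (0≤w′ ∷ nonNeg) (there Sw∈y) both∈S =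
    ℚ.≤-trans (∈⇒≤bothWeight y nonNeg Sw∈y both∈S)
              (≤-if-+ (lookup S′ u ∧ lookup S′ v) 0≤w′)

  total-nonPositive : ∀ y → All (λ p → proj₂ p ≤ 0ℚ) y → total G y ≤ 0ℚ
  total-nonPositive [] [] = ℚ.≤-refl
  total-nonPositive (_ ∷ y) (w≤0 ∷ nonPos) =
    ℚ.≤-trans (ℚ.+-mono-≤ w≤0 (total-nonPositive y nonPos))
              (ℚ.≤-reflexive (ℚ.+-identityʳ 0ℚ))

  total+bothWeight≤2 : ∀ {u v} y → Feasible G y → Edge G u v →
                       total G y ℚ.+ bothWeight u v y ≤ two
  total+bothWeight≤2 {u} {v} y (members , load≤1) e = begin
    total G y ℚ.+ bothWeight u v y
      ≡⟨ ≡.sym (weightAt+weightAt≡total+bothWeight y (All.map proj₁ members) e) ⟩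
    weightAt G u y ℚ.+ weightAt G v y
      ≤⟨ ℚ.+-mono-≤ (load≤1 u) (load≤1 v) ⟩
    two                               ∎
    where open ℚ.≤-Reasoning

  total≤2 : ∀ {u v} y → Feasible G y → Edge G u v → total G y ≤ two
  total≤2 y feasible@(members , _) e =
    ℚ.≤-trans (p≤p+q (bothWeight-nonNegative y (All.map proj₂ members)))
              (total+bothWeight≤2 y feasible e)

  κ⇒bipartite : KappaF-equals G two → Bipartite G
  κ⇒bipartite ((y , feasible@(members , _) , total≡2) , _) with any? (λ p → 0ℚ <? proj₂ p) y
  ... | no noPositive = ⊥-elim (ℚ.<-irrefl refl (ℚ.<-≤-trans 0<2 (begin
        two        ≡⟨ ≡.sym total≡2 ⟩
        total G y  ≤⟨ total-nonPositive y (All.map ℚ.≮⇒≥ (¬Any⇒All¬ y noPositive)) ⟩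
        0ℚ         ∎)))
    where
    open ℚ.≤-Reasoning
    0<2 : 0ℚ < two
    0<2 = toWitness {a? = 0ℚ <? two} tt
  ... | yes positive with find positive
  ... | (S , w) , Sw∈y , 0<w =
    independentCover⇒bipartite S (proj₁ (All.lookup members Sw∈y)) independent
    where
    open ℚ.≤-Reasoning
    independent : Independent S
    independent u v e both∈S = ℚ.<-irrefl refl (begin-strict
      two                            <⟨ p<p+q 0<w ⟩
      two ℚ.+ w                      ≡⟨ cong (ℚ._+ w) (≡.sym total≡2) ⟩
      total G y ℚ.+ w                ≤⟨ ℚ.+-monoʳ-≤ (total G y) w≤bothWeight ⟩
      total G y ℚ.+ bothWeight u v y ≤⟨ total+bothWeight≤2 y feasible e ⟩
      two                            ∎)
      where
      w≤bothWeight : w ≤ bothWeight u v y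
      w≤bothWeight = ∈⇒≤bothWeight y (All.map proj₂ members) Sw∈y both∈S

  weightAt-colourClasses : ∀ c w v y →
    weightAt G v ((tabulate c , w) ∷ (tabulate (not ∘ c) , w) ∷ y) ≡ w ℚ.+ weightAt G v y
  weightAt-colourClasses c w v y
    rewrite lookup∘tabulate c v | lookup∘tabulate (not ∘ c) v with c v
  ... | true  = refl
  ... | false = refl

  bipartite⇒κ : HasEdge G → Bipartite G → KappaF-equals G two
  bipartite⇒κ (_ , _ , e) (c , proper) =
    (y , (members , load≤1) , refl) , λ z feasible → total≤2 z feasible e
    where
    y : List (Subset n × ℚ)
    y = (tabulate c , 1ℚ) ∷ (tabulate (not ∘ c) , 1ℚ) ∷ []
    0≤1 : 0ℚ ≤ 1ℚ
    0≤1 = toWitness {a? = 0ℚ ≤? 1ℚ} tt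
    members : All (λ p → IsVertexCover G (proj₁ p) × 0ℚ ≤ proj₂ p) y
    members = (colourClass-vertexCover c proper , 0≤1)
            ∷ (colourClass-vertexCover (not ∘ c) (not-properColouring proper) , 0≤1) ∷ []
    load≤1 : ∀ x → weightAt G x y ≤ 1ℚ
    load≤1 x =
      ℚ.≤-reflexive (≡.trans (weightAt-colourClasses c 1ℚ x []) (ℚ.+-identityʳ 1ℚ))

proposition4 : ∀ (n : ℕ) (G : Graph n) → Connected G → HasEdge G →
    (KappaF-equals G (Data.Rational.1ℚ Data.Rational.+ Data.Rational.1ℚ) ⇔ Bipartite G)
    × ((∃ λ b → b ≥ 1 × T-equals G b (2 * b)) ⇔ Bipartite G)
    × ((∀ b → b ≥ 1 → T-equals G b (2 * b)) ⇔ Bipartite G)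
proposition4 n G _connected hasEdge =
    mk⇔ (κ⇒bipartite G) (bipartite⇒κ G hasEdge)
  , mk⇔ (λ (b , b≥1 , T≡2b) → T⇒bipartite G b b≥1 T≡2b)
        (λ bipartite → 1 , ℕ.≤-refl , bipartite⇒T G hasEdge bipartite 1)
  , mk⇔ (λ T≡2b → T⇒bipartite G 1 ℕ.≤-refl (T≡2b 1 ℕ.≤-refl))
        (λ bipartite b _ → bipartite⇒T G hasEdge bipartite b)
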